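{- Let $n\ge 2$, $d\ge0$, and let $C$ be an $n\times n$ circulant matrix with generator $(c_0,\ldots,c_{n-1})$ such that $c_0=d$, $c_j\in\{1,-1\}$ for $j=1,\ldots,n-1$, and $CC^T=(d^2+n-1)I$. If $C$ is not symmetric, then $d$ is an odd integer and $n\equiv 0\pmod 4$.
   Context: A circulant matrix of order $n$ with generator $(c_0,c_1,\ldots,c_{n-1})$ is the $n\times n$ matrix whose entry in row $i$ and column $j$ (indices $0,\ldots,n-1$) is $c_{(j-i)\bmod n}$.
   Formalization: The parameter $d$ ranges over the nonnegative rationals instead of the reals. -}

module Defs where

open import Data.Nat using (ℕ; zero; suc; _+_; _∸_)
open import Data.Nat.DivMod using (_mod_)
open import Data.Fin using (Fin; toℕ) renaming (zero to fzero; suc to fsuc)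
open import Data.Integer using (ℤ)
open import Data.Rational using (ℚ; 0ℚ; 1ℚ) renaming (_+_ to _+ℚ_; _*_ to _*ℚ_; _/_ to _/ℚ_)
open import Relation.Binary.PropositionalEquality using (_≡_)
open import Relation.Nullary using (Dec; yes; no)
open import Data.Fin using (_≟_)

Matrix : ℕ → Set
Matrix n = Fin n → Fin n → ℚ

modSub : ∀ {n} → Fin n → Fin n → Fin n
modSub {suc m} j i = (toℕ j + suc m ∸ toℕ i) mod (suc m)

circulant : ∀ {n} → (Fin n → ℚ) → Matrix n
circulant c i j = c (modSub j i)

sumFin : ∀ n → (Fin n → ℚ) → ℚ
sumFin zero    f = 0ℚ
sumFin (suc n) f = f fzero +ℚ sumFin n (λ k → f (fsuc k))

transpose : ∀ {n} → Matrix n → Matrix n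
transpose A i j = A j i

_·_ : ∀ {n} → Matrix n → Matrix n → Matrix n
_·_ {n} A B i k = sumFin n (λ j → A i j *ℚ B j k)

scalarId : ∀ {n} → ℚ → Matrix n
scalarId a i k with i ≟ k
... | yes _ = a
... | no  _ = 0ℚ

ℕtoℚ : ℕ → ℚ
ℕtoℚ m = ℤ.pos m /ℚ 1

{-# OPTIONS --safe #-}
-- Put s₀ = 1 and sⱼ = cⱼ for j ≠ 0, so that C = S + (c₀ - 1) I for the ±1 circulant S with
-- generator s; off the diagonal, C Cᵀ = S Sᵀ + (c₀ - 1) (S + Sᵀ).  If C(i,j) ≠ C(j,i), these two
-- entries are opposite signs, so rows i and j of S are orthogonal.  Both rows have the same sum
-- σ ≡ n (mod 2), and ab ≡ a + b - 1 (mod 4) for signs a, b, so 0 ≡ 2σ - n ≡ n (mod 4).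
-- Writing n = 2m, rows 0 and m give Σₗ sₗ sₗ₊ₘ + 2 (c₀ - 1) sₘ = 0; the sum is 2T with T a sum of
-- m ≡ 0 (mod 2) signs, so it is 4w, and c₀ = 1 - 2 w sₘ is odd.
module Submission where

open import Defs
open import Data.Nat using (ℕ; zero; suc; _≤_; _∸_; _%_)
open import Data.Fin using (Fin; toℕ; zero; suc; fromℕ<; punchIn)
open import Data.Integer using (ℤ; +_; -[1+_]; 0ℤ; 1ℤ; -1ℤ; ∣_∣)
  renaming (_+_ to _+ℤ_; _*_ to _*ℤ_; _-_ to _-ℤ_; -_ to -ℤ_)
open import Data.Rational using (ℚ; 1ℚ; 0ℚ; -_; _/_; _*_; _+_; _-_; ½; mkℚ; ↥_) renaming (_≤_ to _≤ℚ_)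
open import Data.Product using (∃; ∃₂; _×_; _,_)
open import Data.Sum using (_⊎_; inj₁; inj₂)
open import Relation.Binary.PropositionalEquality
  using (_≡_; _≢_; refl; sym; trans; cong; cong₂; subst; module ≡-Reasoning)
open import Relation.Nullary using (¬_; contradiction; yes; no)

open import Algebra.Bundles using (CommutativeMonoid)
import Algebra.Properties.CommutativeMonoid.Sum as MonoidSum
open import Data.Fin.Properties
  using (¬∀⟶∃¬; all?; toℕ<n; toℕ-injective; toℕ-fromℕ<; fromℕ<-toℕ; fromℕ<-cong; punchInᵢ≢i)
import Data.Integer.Properties as ℤP
open import Data.Integer.Divisibility.Signed
  using (_∣_; divides; quotient; ∣m∣n⇒∣m+n; ∣m⇒∣-m; *-monoʳ-∣; ∣ᵤ⇒∣; ∣⇒∣ᵤ)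
import Data.Integer.Tactic.RingSolver as ℤ-Solver
import Data.Nat as ℕ
import Data.Nat.Coprimality as Coprime
open import Data.Nat.DivMod using (_mod_; m<n⇒m%n≡m; [m+n]%n≡m%n; %-remove-+ˡ; n%n≡0)
open import Data.Nat.Divisibility using (m%n≡0⇒n∣m; n∣m⇒m%n≡0)
import Data.Nat.Divisibility as ℕ
import Data.Nat.Properties as ℕ
import Data.Product as Product
import Data.Rational.Properties as ℚ
import Data.Sum as Sum
open import Data.Vec.Functional using (Vector)
open import Function using (_∘_)
open import Level using (0ℓ)
open import Relation.Nullary.Decidable using (dec⇒maybe)
open import Tactic.RingSolver using (solve-∀)
open import Tactic.RingSolver.Core.AlmostCommutativeRing using (AlmostCommutativeRing; fromCommutativeRing)

module _ {N : ℕ} where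
  private
    n : ℕ
    n = suc N

  toℕ-mod : (j : Fin n) → toℕ j mod n ≡ j
  toℕ-mod j = trans (fromℕ<-cong _ _ (m<n⇒m%n≡m (toℕ<n j)) _ (toℕ<n j)) (fromℕ<-toℕ j _)

  mod-periodic : ∀ x → (n ℕ.+ x) mod n ≡ x mod n
  mod-periodic x = fromℕ<-cong _ _ (trans (cong (_% n) (ℕ.+-comm n x)) ([m+n]%n≡m%n x n)) _ _

  modSub-shift : ∀ (j i : Fin n) {t} → t ℕ.+ toℕ i ≡ n → modSub j i ≡ (t ℕ.+ toℕ j) mod n
  modSub-shift j i {t} t+i≡n = cong (_mod n) (begin
    toℕ j ℕ.+ n ∸ toℕ i               ≡⟨ cong (λ k → toℕ j ℕ.+ k ∸ toℕ i) (sym t+i≡n) ⟩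
    toℕ j ℕ.+ (t ℕ.+ toℕ i) ∸ toℕ i   ≡⟨ cong (_∸ toℕ i) (sym (ℕ.+-assoc (toℕ j) t (toℕ i))) ⟩
    toℕ j ℕ.+ t ℕ.+ toℕ i ∸ toℕ i     ≡⟨ ℕ.m+n∸n≡m (toℕ j ℕ.+ t) (toℕ i) ⟩
    toℕ j ℕ.+ t                       ≡⟨ ℕ.+-comm (toℕ j) t ⟩
    t ℕ.+ toℕ j                       ∎)
    where open ≡-Reasoning

  modSub-zero : (j : Fin n) → modSub j zero ≡ j
  modSub-zero j = trans (modSub-shift j zero (ℕ.+-identityʳ n)) (trans (mod-periodic (toℕ j)) (toℕ-mod j))

  modSub-self : (i : Fin n) → modSub i i ≡ zero
  modSub-self i = toℕ-injective (trans (toℕ-fromℕ< _) (trans (cong (_% n) (ℕ.m+n∸m≡n (toℕ i) n)) (n%n≡0 n)))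

  modSub≡zero⇒≡ : ∀ {j i : Fin n} → modSub j i ≡ zero → j ≡ i
  modSub≡zero⇒≡ {j} {i} j⊖i≡0 = sym (toℕ-injective (begin
    toℕ i                     ≡⟨ m<n⇒m%n≡m (toℕ<n i) ⟨
    toℕ i % n                 ≡⟨ %-remove-+ˡ (toℕ i) n∣x ⟨
    (x ℕ.+ toℕ i) % n         ≡⟨ cong (_% n) (ℕ.m∸n+n≡m (ℕ.≤-trans (ℕ.<⇒≤ (toℕ<n i)) (ℕ.m≤n+m n (toℕ j)))) ⟩
    (toℕ j ℕ.+ n) % n         ≡⟨ [m+n]%n≡m%n (toℕ j) n ⟩
    toℕ j % n                 ≡⟨ m<n⇒m%n≡m (toℕ<n j) ⟩
    toℕ j                     ∎))
    where
    open ≡-Reasoning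
    x = toℕ j ℕ.+ n ∸ toℕ i
    n∣x = m%n≡0⇒n∣m x n (trans (sym (toℕ-fromℕ< _)) (cong toℕ j⊖i≡0))

  modSub≢zero : ∀ {j i : Fin n} → j ≢ i → modSub j i ≢ zero
  modSub≢zero j≢i = j≢i ∘ modSub≡zero⇒≡

  modSub-antipode : ∀ {k : Fin n} → toℕ k ℕ.+ toℕ k ≡ n → modSub zero k ≡ k
  modSub-antipode {k} k+k≡n =
    trans (modSub-shift zero k k+k≡n) (trans (cong (_mod n) (ℕ.+-identityʳ (toℕ k))) (toℕ-mod k))

  antipode : 2 ℕ.∣ n → ∃ λ (k : Fin n) → toℕ k ℕ.+ toℕ k ≡ n
  antipode (ℕ.divides q n≡q*2) = fromℕ< q<n , trans (cong (λ x → x ℕ.+ x) (toℕ-fromℕ< q<n)) q+q≡n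
    where
    q+q≡n : q ℕ.+ q ≡ n
    q+q≡n = trans (cong (q ℕ.+_) (sym (ℕ.+-identityʳ q))) (trans (ℕ.*-comm 2 q) (sym n≡q*2))
    q≢0 : q ≢ 0
    q≢0 q≡0 = ℕ.1+n≢0 (trans (sym q+q≡n) (cong₂ ℕ._+_ q≡0 q≡0))
    q<n : q ℕ.< n
    q<n = subst (q ℕ.<_) q+q≡n (ℕ.m<m+n q (ℕ.n≢0⇒n>0 q≢0))

module _ {a ℓ} (M : CommutativeMonoid a ℓ) where
  open CommutativeMonoid M hiding (refl) renaming (sym to ≈-sym; trans to ≈-trans)
  open MonoidSum M
  open import Relation.Binary.Reasoning.Setoid setoid

  sum-split : ∀ {k} m n → m ℕ.+ n ≡ k → (f : ℕ → Carrier) →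
    ∑[ l < k ] f (toℕ l) ≈ ∑[ l < m ] f (toℕ l) ∙ ∑[ l < n ] f (m ℕ.+ toℕ l)
  sum-split zero    n refl f = ≈-sym (identityˡ _)
  sum-split (suc m) n refl f = ≈-trans (∙-congˡ (sum-split m n refl (f ∘ suc))) (≈-sym (assoc _ _ _))

  sum-rotate : ∀ {n} t → t ℕ.≤ n → (f : ℕ → Carrier) → (∀ x → f (n ℕ.+ x) ≈ f x) →
    ∑[ l < n ] f (t ℕ.+ toℕ l) ≈ ∑[ l < n ] f (toℕ l)
  sum-rotate {n} t t≤n f periodic = begin
    ∑[ l < n ] f (t ℕ.+ toℕ l)                                     ≈⟨ sum-split r t (ℕ.m∸n+n≡m t≤n) (f ∘ (t ℕ.+_)) ⟩
    ∑[ l < r ] f (t ℕ.+ toℕ l) ∙ ∑[ l < t ] f (t ℕ.+ (r ℕ.+ toℕ l)) ≈⟨ ∙-congˡ (sum-cong-≋ {t} wrap-around) ⟩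
    ∑[ l < r ] f (t ℕ.+ toℕ l) ∙ ∑[ l < t ] f (toℕ l)               ≈⟨ comm _ _ ⟩
    ∑[ l < t ] f (toℕ l) ∙ ∑[ l < r ] f (t ℕ.+ toℕ l)               ≈⟨ sum-split t r (ℕ.m+[n∸m]≡n t≤n) f ⟨
    ∑[ l < n ] f (toℕ l)                                           ∎
    where
    r = n ∸ t
    wrap-around : ∀ (l : Fin t) → f (t ℕ.+ (r ℕ.+ toℕ l)) ≈ f (toℕ l)
    wrap-around l = ≈-trans (reflexive (cong f t+[r+l]≡n+l)) (periodic (toℕ l))
      where
      t+[r+l]≡n+l = trans (sym (ℕ.+-assoc t r (toℕ l))) (cong (ℕ._+ toℕ l) (ℕ.m+[n∸m]≡n t≤n))

  sum-double : ∀ {n} m → m ℕ.+ m ≡ n → (f : ℕ → Carrier) → (∀ x → f (m ℕ.+ x) ≈ f x) →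
    ∑[ l < n ] f (toℕ l) ≈ ∑[ l < m ] f (toℕ l) ∙ ∑[ l < m ] f (toℕ l)
  sum-double m m+m≡n f periodic = ≈-trans (sum-split m m m+m≡n f) (∙-congˡ (sum-cong-≋ {m} (periodic ∘ toℕ)))

  sum-supported : ∀ {n} (f : Vector Carrier (suc n)) i → (∀ j → j ≢ i → f j ≈ ε) → sum f ≈ f i
  sum-supported {n} f i vanishes = begin
    sum f                            ≈⟨ sum-remove {i = i} f ⟩
    f i ∙ ∑[ j < n ] f (punchIn i j) ≈⟨ ∙-congˡ (sum-cong-≋ (λ j → vanishes (punchIn i j) (punchInᵢ≢i i j))) ⟩
    f i ∙ ∑[ j < n ] ε               ≈⟨ ∙-congˡ (sum-replicate-zero n) ⟩
    f i ∙ ε                          ≈⟨ identityʳ _ ⟩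
    f i                              ∎

  sum-modSub : ∀ {N} (f : Fin (suc N) → Carrier) i → ∑[ l < suc N ] f (modSub l i) ≈ sum f
  sum-modSub {N} f i = begin
    ∑[ l < n ] f (modSub l i)            ≡⟨ sum-cong-≗ (cong f ∘ λ l → modSub-shift l i (ℕ.m∸n+n≡m i≤n)) ⟩
    ∑[ l < n ] f ((t ℕ.+ toℕ l) mod n)   ≈⟨ sum-rotate t (ℕ.m∸n≤m n (toℕ i)) (λ x → f (x mod n))
                                                     (reflexive ∘ cong f ∘ mod-periodic) ⟩
    ∑[ l < n ] f (toℕ l mod n)           ≡⟨ sum-cong-≗ (cong f ∘ toℕ-mod) ⟩
    sum f                                ∎
    where
    n = suc N
    t = n ∸ toℕ i
    i≤n = ℕ.<⇒≤ (toℕ<n i)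

module ℤΣ = MonoidSum ℤP.+-0-commutativeMonoid

IsSign : ℤ → Set
IsSign z = z ≡ 1ℤ ⊎ z ≡ -1ℤ

sign-* : ∀ {a b} → IsSign a → IsSign b → IsSign (a *ℤ b)
sign-* (inj₁ refl) (inj₁ refl) = inj₁ refl
sign-* (inj₁ refl) (inj₂ refl) = inj₂ refl
sign-* (inj₂ refl) (inj₁ refl) = inj₂ refl
sign-* (inj₂ refl) (inj₂ refl) = inj₁ refl

2∣sign-1 : ∀ {a} → IsSign a → + 2 ∣ a -ℤ 1ℤ
2∣sign-1 (inj₁ refl) = divides 0ℤ refl
2∣sign-1 (inj₂ refl) = divides -1ℤ refl

4∣[sign-1]*[sign-1] : ∀ {a b} → IsSign a → IsSign b → + 4 ∣ (a -ℤ 1ℤ) *ℤ (b -ℤ 1ℤ)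
4∣[sign-1]*[sign-1] (inj₁ refl) _           = divides 0ℤ refl
4∣[sign-1]*[sign-1] (inj₂ refl) (inj₁ refl) = divides 0ℤ refl
4∣[sign-1]*[sign-1] (inj₂ refl) (inj₂ refl) = divides 1ℤ refl

module _ where
  open ℤΣ

  sum-signs-mod-2 : ∀ {n} (a : Vector ℤ n) → (∀ l → IsSign (a l)) → + 2 ∣ sum a -ℤ + n
  sum-signs-mod-2 {zero}  a _    = divides 0ℤ refl
  sum-signs-mod-2 {suc n} a sign =
    subst (+ 2 ∣_) (regroup (a zero) (sum (a ∘ suc)) (+ n))
      (∣m∣n⇒∣m+n (2∣sign-1 (sign zero)) (sum-signs-mod-2 (a ∘ suc) (sign ∘ suc)))
    where
    regroup : ∀ x y k → (x -ℤ 1ℤ) +ℤ (y -ℤ k) ≡ (x +ℤ y) -ℤ (1ℤ +ℤ k)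
    regroup = ℤ-Solver.solve-∀

  sum-sign-products-mod-4 : ∀ {n} (a b : Vector ℤ n) → (∀ l → IsSign (a l)) → (∀ l → IsSign (b l)) →
    + 4 ∣ sum (λ l → a l *ℤ b l) -ℤ sum a -ℤ sum b +ℤ + n
  sum-sign-products-mod-4 {zero}  a b _ _ = divides 0ℤ refl
  sum-sign-products-mod-4 {suc n} a b sign-a sign-b =
    subst (+ 4 ∣_) (regroup (a zero) (b zero) (sum (λ l → a (suc l) *ℤ b (suc l))) (sum (a ∘ suc)) (sum (b ∘ suc)) (+ n))
      (∣m∣n⇒∣m+n (4∣[sign-1]*[sign-1] (sign-a zero) (sign-b zero))
                 (sum-sign-products-mod-4 (a ∘ suc) (b ∘ suc) (sign-a ∘ suc) (sign-b ∘ suc)))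
    where
    regroup : ∀ x y p s t k → (x -ℤ 1ℤ) *ℤ (y -ℤ 1ℤ) +ℤ (p -ℤ s -ℤ t +ℤ k)
                            ≡ (x *ℤ y +ℤ p) -ℤ (x +ℤ s) -ℤ (y +ℤ t) +ℤ (1ℤ +ℤ k)
    regroup = ℤ-Solver.solve-∀

  orthogonal-signs⇒4∣length : ∀ {n} (a b : Vector ℤ n) → (∀ l → IsSign (a l)) → (∀ l → IsSign (b l)) →
    sum a ≡ sum b → sum (λ l → a l *ℤ b l) ≡ 0ℤ → + 4 ∣ + n
  orthogonal-signs⇒4∣length {n} a b sign-a sign-b Σa≡Σb Σab≡0 =
    subst (+ 4 ∣_) (ℤP.neg-involutive (+ n)) (∣m⇒∣-m (subst (+ 4 ∣_) (cancel S (+ n)) 4∣sum))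
    where
    S = sum b
    4∣sum : + 4 ∣ (0ℤ -ℤ S -ℤ S +ℤ + n) +ℤ + 2 *ℤ (S -ℤ + n)
    4∣sum = ∣m∣n⇒∣m+n
      (subst (λ z → + 4 ∣ z -ℤ S -ℤ S +ℤ + n) Σab≡0
        (subst (λ z → + 4 ∣ sum (λ l → a l *ℤ b l) -ℤ z -ℤ S +ℤ + n) Σa≡Σb (sum-sign-products-mod-4 a b sign-a sign-b)))
      (*-monoʳ-∣ (+ 2) (sum-signs-mod-2 b sign-b))
    cancel : ∀ s k → (0ℤ -ℤ s -ℤ s +ℤ k) +ℤ + 2 *ℤ (s -ℤ k) ≡ -ℤ k
    cancel = ℤ-Solver.solve-∀

  periodic-signs⇒4∣sum : ∀ {n} m → m ℕ.+ m ≡ n → (g : ℕ → ℤ) → (∀ x → IsSign (g x)) → (∀ x → g (m ℕ.+ x) ≡ g x) →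
    + 4 ∣ + n → + 4 ∣ ∑[ l < n ] g (toℕ l)
  periodic-signs⇒4∣sum {n} m m+m≡n g sign periodic 4∣n =
    subst (+ 4 ∣_) (trans (regroup T (+ m)) (sym (sum-double ℤP.+-0-commutativeMonoid m m+m≡n g periodic)))
      (∣m∣n⇒∣m+n (*-monoʳ-∣ (+ 2) (sum-signs-mod-2 {m} (g ∘ toℕ) (sign ∘ toℕ))) (subst (λ k → + 4 ∣ + k) (sym m+m≡n) 4∣n))
    where
    T = ∑[ l < m ] g (toℕ l)
    regroup : ∀ t k → + 2 *ℤ (t -ℤ k) +ℤ (k +ℤ k) ≡ t +ℤ t
    regroup = ℤ-Solver.solve-∀

  shifted-orthogonal-signs⇒4∣n : ∀ {N} (s : Fin (suc N) → ℤ) → (∀ j → IsSign (s j)) → ∀ i j →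
    ∑[ l < suc N ] (s (modSub l i) *ℤ s (modSub l j)) ≡ 0ℤ → + 4 ∣ + suc N
  shifted-orthogonal-signs⇒4∣n s sign i j =
    orthogonal-signs⇒4∣length (λ l → s (modSub l i)) (λ l → s (modSub l j))
                              (λ l → sign (modSub l i)) (λ l → sign (modSub l j))
      (trans (sum-modSub ℤP.+-0-commutativeMonoid s i) (sym (sum-modSub ℤP.+-0-commutativeMonoid s j)))

  antipodal-autocorrelation : ∀ {N} (s : Fin (suc N) → ℤ) → (∀ j → IsSign (s j)) →
    ∀ {k} → toℕ k ℕ.+ toℕ k ≡ suc N → + 4 ∣ + suc N → + 4 ∣ ∑[ l < suc N ] (s (modSub l zero) *ℤ s (modSub l k))
  antipodal-autocorrelation {N} s sign {k} k+k≡n 4∣n =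
    subst (+ 4 ∣_) (sym (sum-cong-≗ {n} Σ-terms≡g))
      (periodic-signs⇒4∣sum m k+k≡n g (λ x → sign-* (sign (x mod n)) (sign ((m ℕ.+ x) mod n))) g-periodic 4∣n)
    where
    n = suc N
    m = toℕ k
    ŝ g : ℕ → ℤ
    ŝ x = s (x mod n)
    g x = ŝ x *ℤ ŝ (m ℕ.+ x)
    g-periodic : ∀ x → g (m ℕ.+ x) ≡ g x
    g-periodic x = trans (cong (ŝ (m ℕ.+ x) *ℤ_) ŝ[m+m+x]≡ŝx) (ℤP.*-comm (ŝ (m ℕ.+ x)) (ŝ x))
      where
      ŝ[m+m+x]≡ŝx : ŝ (m ℕ.+ (m ℕ.+ x)) ≡ ŝ x
      ŝ[m+m+x]≡ŝx = cong s (trans (cong (_mod n) (trans (sym (ℕ.+-assoc m m x)) (cong (ℕ._+ x) k+k≡n))) (mod-periodic x))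
    Σ-terms≡g : ∀ l → s (modSub l zero) *ℤ s (modSub l k) ≡ g (toℕ l)
    Σ-terms≡g l = cong₂ _*ℤ_ (cong s (trans (modSub-zero l) (sym (toℕ-mod l)))) (cong s (modSub-shift l k k+k≡n))

module ℚΣ = MonoidSum ℚ.+-0-commutativeMonoid

fromℤ : ℤ → ℚ
fromℤ z = mkℚ z 0 (Coprime.sym (Coprime.1-coprimeTo ∣ z ∣))

/1≡fromℤ : ∀ z → z / 1 ≡ fromℤ z
/1≡fromℤ z = ℚ.↥p/↧p≡p (fromℤ z)

fromℤ-homo-+ : ∀ a b → fromℤ (a +ℤ b) ≡ fromℤ a + fromℤ b
fromℤ-homo-+ a b = sym (trans (cong₂ (λ x y → (x +ℤ y) / 1) (ℤP.*-identityʳ a) (ℤP.*-identityʳ b)) (/1≡fromℤ (a +ℤ b)))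

fromℤ-homo-* : ∀ a b → fromℤ (a *ℤ b) ≡ fromℤ a * fromℤ b
fromℤ-homo-* a b = sym (/1≡fromℤ (a *ℤ b))

fromℤ-homo‿- : ∀ a → fromℤ (-ℤ a) ≡ - fromℤ a
fromℤ-homo‿- (+ zero)  = refl
fromℤ-homo‿- (+ suc _) = refl
fromℤ-homo‿- -[1+ _ ] = refl

fromℤ-injective : ∀ {a b} → fromℤ a ≡ fromℤ b → a ≡ b
fromℤ-injective = cong ↥_

fromℤ-sum : ∀ {n} (f : Vector ℤ n) → fromℤ (ℤΣ.sum f) ≡ ℚΣ.sum (fromℤ ∘ f)
fromℤ-sum {zero}  f = refl
fromℤ-sum {suc n} f = trans (fromℤ-homo-+ (f zero) _) (cong (_+_ (fromℤ (f zero))) (fromℤ-sum (f ∘ suc)))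

sumFin≡sum : ∀ n (f : Vector ℚ n) → sumFin n f ≡ ℚΣ.sum f
sumFin≡sum zero    f = refl
sumFin≡sum (suc n) f = cong (_+_ (f zero)) (sumFin≡sum n (f ∘ suc))

IsSignℚ : ℚ → Set
IsSignℚ q = q ≡ 1ℚ ⊎ q ≡ - 1ℚ

↥-sign : ∀ {q} → IsSignℚ q → IsSign (↥ q)
↥-sign = Sum.map (cong ↥_) (cong ↥_)

≡fromℤ-↥ : ∀ {q} → IsSignℚ q → q ≡ fromℤ (↥ q)
≡fromℤ-↥ (inj₁ refl) = refl
≡fromℤ-↥ (inj₂ refl) = refl

signℚ-*-self : ∀ {u} → IsSignℚ u → u * u ≡ 1ℚ
signℚ-*-self (inj₁ refl) = refl
signℚ-*-self (inj₂ refl) = refl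

signℚ-+-≢ : ∀ {x y} → IsSignℚ x → IsSignℚ y → x ≢ y → x + y ≡ 0ℚ
signℚ-+-≢ (inj₁ refl) (inj₁ refl) x≢y = contradiction refl x≢y
signℚ-+-≢ (inj₁ refl) (inj₂ refl) _   = refl
signℚ-+-≢ (inj₂ refl) (inj₁ refl) _   = refl
signℚ-+-≢ (inj₂ refl) (inj₂ refl) x≢y = contradiction refl x≢y

ℚ-ring : AlmostCommutativeRing 0ℓ 0ℓ
ℚ-ring = fromCommutativeRing ℚ.+-*-commutativeRing (λ q → dec⇒maybe (0ℚ ℚ.≟ q))

row-equation⇒odd : ∀ d w v → IsSign v → fromℤ (w *ℤ + 4) + (d - 1ℚ) * (fromℤ v + fromℤ v) ≡ 0ℚ →
  d ≡ fromℤ (1ℤ +ℤ + 2 *ℤ -ℤ (w *ℤ v))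
row-equation⇒odd d w v sign equation = begin
  d
    ≡⟨ eliminate d W V ⟩
  1ℚ + two * - (W * V) + (d - 1ℚ) * (1ℚ - V * V) + ½ * V * E
    ≡⟨ cong₂ (λ x y → 1ℚ + two * - (W * V) + (d - 1ℚ) * (1ℚ - x) + ½ * V * y) V*V≡1 E≡0 ⟩
  1ℚ + two * - (W * V) + (d - 1ℚ) * (1ℚ - 1ℚ) + ½ * V * 0ℚ
    ≡⟨ simplify d W V ⟩
  1ℚ + two * - (W * V)
    ≡⟨ fromℤ-odd ⟨
  fromℤ (1ℤ +ℤ + 2 *ℤ -ℤ (w *ℤ v))
    ∎
  where
  open ≡-Reasoning
  W = fromℤ w
  V = fromℤ v
  two = fromℤ (+ 2)
  four = fromℤ (+ 4)
  E = W * four + (d - 1ℚ) * (V + V)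
  E≡0 : E ≡ 0ℚ
  E≡0 = trans (cong (λ x → x + (d - 1ℚ) * (V + V)) (sym (fromℤ-homo-* w (+ 4)))) equation
  V*V≡1 : V * V ≡ 1ℚ
  V*V≡1 = signℚ-*-self (Sum.map (cong fromℤ) (cong fromℤ) sign)
  -- Multiplying the row equation E ≡ 0 by V/2 and using V * V ≡ 1 isolates d.
  eliminate : ∀ d W V → d ≡ 1ℚ + two * - (W * V) + (d - 1ℚ) * (1ℚ - V * V) + ½ * V * (W * four + (d - 1ℚ) * (V + V))
  eliminate = solve-∀ ℚ-ring
  simplify : ∀ d W V → 1ℚ + two * - (W * V) + (d - 1ℚ) * (1ℚ - 1ℚ) + ½ * V * 0ℚ ≡ 1ℚ + two * - (W * V)
  simplify = solve-∀ ℚ-ring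
  fromℤ-odd : fromℤ (1ℤ +ℤ + 2 *ℤ -ℤ (w *ℤ v)) ≡ 1ℚ + two * - (W * V)
  fromℤ-odd = begin
    fromℤ (1ℤ +ℤ + 2 *ℤ -ℤ (w *ℤ v)) ≡⟨ fromℤ-homo-+ 1ℤ (+ 2 *ℤ -ℤ (w *ℤ v)) ⟩
    1ℚ + fromℤ (+ 2 *ℤ -ℤ (w *ℤ v))  ≡⟨ cong (_+_ 1ℚ) (fromℤ-homo-* (+ 2) (-ℤ (w *ℤ v))) ⟩
    1ℚ + two * fromℤ (-ℤ (w *ℤ v))   ≡⟨ cong (λ x → 1ℚ + two * x) (fromℤ-homo‿- (w *ℤ v)) ⟩
    1ℚ + two * - fromℤ (w *ℤ v)      ≡⟨ cong (λ x → 1ℚ + two * - x) (fromℤ-homo-* w v) ⟩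
    1ℚ + two * - (W * V)             ∎

module _ where
  open ℚΣ

  sum-perturbed-product : ∀ {n} (a e b f : Vector ℚ (suc n)) i k →
    (∀ j → j ≢ i → e j ≡ 0ℚ) → (∀ j → j ≢ k → f j ≡ 0ℚ) →
    ∑[ l < suc n ] ((a l + e l) * (b l + f l)) ≡ ∑[ l < suc n ] (a l * b l) + (a k * f k + e i * (b i + f i))
  sum-perturbed-product {n} a e b f i k e-vanishes f-vanishes = begin
    ∑[ l < suc n ] ((a l + e l) * (b l + f l))                  ≡⟨ sum-cong-≗ (λ l → expand (a l) (e l) (b l) (f l)) ⟩
    ∑[ l < suc n ] (ab l + (af l + eB l))                       ≡⟨ ∑-distrib-+ ab (λ l → af l + eB l) ⟩
    sum ab + ∑[ l < suc n ] (af l + eB l)                       ≡⟨ cong (_+_ (sum ab)) (∑-distrib-+ af eB) ⟩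
    sum ab + (sum af + sum eB)                                  ≡⟨ cong₂ (λ x y → sum ab + (x + y))
                                                                     (sum-supported ℚ.+-0-commutativeMonoid af k af-vanishes)
                                                                     (sum-supported ℚ.+-0-commutativeMonoid eB i eB-vanishes) ⟩
    sum ab + (a k * f k + e i * (b i + f i))                    ∎
    where
    open ≡-Reasoning
    ab af eB : Vector ℚ (suc n)
    ab l = a l * b l
    af l = a l * f l
    eB l = e l * (b l + f l)
    af-vanishes : ∀ j → j ≢ k → af j ≡ 0ℚ
    af-vanishes j j≢k = trans (cong (_*_ (a j)) (f-vanishes j j≢k)) (ℚ.*-zeroʳ (a j))
    eB-vanishes : ∀ j → j ≢ i → eB j ≡ 0ℚ
    eB-vanishes j j≢i = trans (cong (_* (b j + f j)) (e-vanishes j j≢i)) (ℚ.*-zeroˡ (b j + f j))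
    expand : ∀ a e b f → (a + e) * (b + f) ≡ a * b + (a * f + e * (b + f))
    expand = solve-∀ ℚ-ring

scalarId-offDiagonal : ∀ {n} a {i k : Fin n} → i ≢ k → scalarId a i k ≡ 0ℚ
scalarId-offDiagonal a {i} {k} i≢k with i Data.Fin.≟ k
... | yes i≡k = contradiction i≡k i≢k
... | no  _   = refl

asymmetric-entry : ∀ {n} (A : Matrix n) → ¬ (∀ i j → A i j ≡ A j i) → ∃₂ λ i j → A i j ≢ A j i
asymmetric-entry {n} A asymmetric with ¬∀⟶∃¬ n _ (λ i → all? (λ j → A i j ℚ.≟ A j i)) asymmetric
... | i , asymmetric-row with ¬∀⟶∃¬ n _ (λ j → A i j ℚ.≟ A j i) asymmetric-row
...   | j , Aij≢Aji = i , j , Aij≢Aji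

module SignDecomposition {N : ℕ} (c : Fin (suc N) → ℚ) (c-sign : ∀ j → IsSignℚ (c (suc j))) where
  open ℚΣ
  open ≡-Reasoning

  private
    n : ℕ
    n = suc N

  C : Matrix n
  C = circulant c

  s : Fin n → ℤ
  s zero    = 1ℤ
  s (suc j) = ↥ c (suc j)

  s-sign : ∀ j → IsSign (s j)
  s-sign zero    = inj₁ refl
  s-sign (suc j) = ↥-sign (c-sign j)

  c-sign-nonzero : ∀ {j} → j ≢ zero → IsSignℚ (c j)
  c-sign-nonzero {zero}  j≢0 = contradiction refl j≢0
  c-sign-nonzero {suc j} _   = c-sign j

  c≡s : ∀ {j} → j ≢ zero → c j ≡ fromℤ (s j)
  c≡s {zero}  j≢0 = contradiction refl j≢0
  c≡s {suc j} _   = ≡fromℤ-↥ (c-sign j)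

  excess : Fin n → ℚ
  excess j = c j - fromℤ (s j)

  c≡s+excess : ∀ j → c j ≡ fromℤ (s j) + excess j
  c≡s+excess j = split (c j) (fromℤ (s j))
    where
    split : ∀ x y → x ≡ y + (x - y)
    split = solve-∀ ℚ-ring

  excess-vanishes : ∀ {j} → j ≢ zero → excess j ≡ 0ℚ
  excess-vanishes {j} j≢0 = trans (cong (_- fromℤ (s j)) (c≡s j≢0)) (ℚ.+-inverseʳ (fromℤ (s j)))

  CCᵀ-offDiagonal : ∀ {i k} → i ≢ k →
    (C · transpose C) i k ≡ fromℤ (ℤΣ.sum (λ l → s (modSub l i) *ℤ s (modSub l k))) + (c zero - 1ℚ) * (C i k + C k i)
  CCᵀ-offDiagonal {i} {k} i≢k = begin
    (C · transpose C) i k                                       ≡⟨ sumFin≡sum n (λ l → c (modSub l i) * c (modSub l k)) ⟩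
    ∑[ l < n ] (c (modSub l i) * c (modSub l k))                ≡⟨ sum-cong-≗ (λ l → cong₂ _*_ (c≡s+excess (modSub l i))
                                                                                                (c≡s+excess (modSub l k))) ⟩
    ∑[ l < n ] ((a l + e l) * (b l + f l))                      ≡⟨ sum-perturbed-product a e b f i k
                                                                     (λ j → excess-vanishes ∘ modSub≢zero)
                                                                     (λ j → excess-vanishes ∘ modSub≢zero) ⟩
    ∑[ l < n ] (a l * b l) + (a k * f k + e i * (b i + f i))    ≡⟨ cong₂ _+_ sum-ab (cong₂ _+_ corner-k corner-i) ⟩
    fromℤ Σss + (C i k * (c zero - 1ℚ) + (c zero - 1ℚ) * C k i) ≡⟨ factor (fromℤ Σss) (c zero - 1ℚ) (C i k) (C k i) ⟩
    fromℤ Σss + (c zero - 1ℚ) * (C i k + C k i)                 ∎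
    where
    a e b f : Vector ℚ n
    a l = fromℤ (s (modSub l i))
    e l = excess (modSub l i)
    b l = fromℤ (s (modSub l k))
    f l = excess (modSub l k)
    Σss = ℤΣ.sum (λ l → s (modSub l i) *ℤ s (modSub l k))
    sum-ab : ∑[ l < n ] (a l * b l) ≡ fromℤ Σss
    sum-ab = trans (sum-cong-≗ (λ l → sym (fromℤ-homo-* (s (modSub l i)) (s (modSub l k)))))
                   (sym (fromℤ-sum {n} (λ l → s (modSub l i) *ℤ s (modSub l k))))
    corner-k : a k * f k ≡ C i k * (c zero - 1ℚ)
    corner-k = cong₂ _*_ (sym (c≡s (modSub≢zero (i≢k ∘ sym)))) (cong excess (modSub-self k))
    corner-i : e i * (b i + f i) ≡ (c zero - 1ℚ) * C k i
    corner-i = cong₂ _*_ (cong excess (modSub-self i)) (sym (c≡s+excess _))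
    factor : ∀ x t y z → x + (y * t + t * z) ≡ x + t * (y + z)
    factor = solve-∀ ℚ-ring

  module _ (orthogonal : ∀ {i k} → i ≢ k → (C · transpose C) i k ≡ 0ℚ) where

    asymmetric⇒4∣n : ∀ {i j} → C i j ≢ C j i → 4 ℕ.∣ n
    asymmetric⇒4∣n {i} {j} Cij≢Cji = ∣⇒∣ᵤ (shifted-orthogonal-signs⇒4∣n s s-sign i j (fromℤ-injective (begin
      fromℤ Σss                                   ≡⟨ ℚ.+-identityʳ (fromℤ Σss) ⟨
      fromℤ Σss + 0ℚ                              ≡⟨ cong (_+_ (fromℤ Σss)) excess-term≡0 ⟨
      fromℤ Σss + (c zero - 1ℚ) * (C i j + C j i) ≡⟨ CCᵀ-offDiagonal i≢j ⟨
      (C · transpose C) i j                       ≡⟨ orthogonal i≢j ⟩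
      0ℚ                                          ∎)))
      where
      i≢j : i ≢ j
      i≢j refl = Cij≢Cji refl
      Σss = ℤΣ.sum (λ l → s (modSub l i) *ℤ s (modSub l j))
      Cij+Cji≡0 : C i j + C j i ≡ 0ℚ
      Cij+Cji≡0 = signℚ-+-≢ (c-sign-nonzero (modSub≢zero (i≢j ∘ sym))) (c-sign-nonzero (modSub≢zero i≢j)) Cij≢Cji
      excess-term≡0 : (c zero - 1ℚ) * (C i j + C j i) ≡ 0ℚ
      excess-term≡0 = trans (cong (_*_ (c zero - 1ℚ)) Cij+Cji≡0) (ℚ.*-zeroʳ (c zero - 1ℚ))

    c₀-odd : 4 ℕ.∣ n → ∃ λ M → c zero ≡ fromℤ (1ℤ +ℤ + 2 *ℤ M)
    c₀-odd 4∣n with antipode (ℕ.∣-trans (ℕ.divides 2 refl) 4∣n)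
    ... | k , k+k≡n = -ℤ (w *ℤ s k) , row-equation⇒odd (c zero) w (s k) (s-sign k) (begin
      fromℤ (w *ℤ + 4) + (c zero - 1ℚ) * (fromℤ (s k) + fromℤ (s k)) ≡⟨ cong₂ (λ x y → fromℤ x + (c zero - 1ℚ) * y)
                                                                           (sym (_∣_.equality 4∣Σss))
                                                                           (sym (cong₂ _+_ C0k≡sk Ck0≡sk)) ⟩
      fromℤ Σss + (c zero - 1ℚ) * (C zero k + C k zero)               ≡⟨ CCᵀ-offDiagonal (k≢0 ∘ sym) ⟨
      (C · transpose C) zero k                                        ≡⟨ orthogonal (k≢0 ∘ sym) ⟩
      0ℚ                                                              ∎)
      where
      k≢0 : k ≢ zero
      k≢0 refl = ℕ.1+n≢0 (sym k+k≡n)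
      Σss = ℤΣ.sum (λ l → s (modSub l zero) *ℤ s (modSub l k))
      4∣Σss : + 4 ∣ Σss
      4∣Σss = antipodal-autocorrelation s s-sign {k} k+k≡n (∣ᵤ⇒∣ 4∣n)
      w = quotient 4∣Σss
      C0k≡sk : C zero k ≡ fromℤ (s k)
      C0k≡sk = trans (cong c (modSub-zero k)) (c≡s k≢0)
      Ck0≡sk : C k zero ≡ fromℤ (s k)
      Ck0≡sk = trans (cong c (modSub-antipode {k = k} k+k≡n)) (c≡s k≢0)

proposition4p10 : (n : ℕ) → 2 ≤ n → (d : ℚ) → 0ℚ ≤ℚ d → (c : Fin n → ℚ) →
    (∀ (j : Fin n) → toℕ j ≡ 0 → c j ≡ d) →
    (∀ (j : Fin n) → toℕ j ≢ 0 → (c j ≡ 1ℚ) ⊎ (c j ≡ - 1ℚ)) →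
    (∀ (i k : Fin n) → (circulant c · transpose (circulant c)) i k ≡ scalarId (d * d + ℕtoℚ (n ∸ 1)) i k) →
    ¬ (∀ (i j : Fin n) → circulant c i j ≡ circulant c j i) →
    (∃ λ (m : ℤ) → d ≡ (Data.Integer._+_ (ℤ.pos 1) (Data.Integer._*_ (ℤ.pos 2) m)) / 1) × (n % 4 ≡ 0)
proposition4p10 zero () _ _ _ _ _ _ _
proposition4p10 (suc N) _ d _ c c₀≡d c-sign CCᵀ≡ asymmetric with asymmetric-entry (circulant c) asymmetric
... | i , j , Cij≢Cji = Product.map₂ d-from-c₀ (c₀-odd orthogonal 4∣n) , n∣m⇒m%n≡0 (suc N) 4 4∣n
  where
  open SignDecomposition c (λ j → c-sign (suc j) (λ ()))
  orthogonal : ∀ {i k} → i ≢ k → (C · transpose C) i k ≡ 0ℚ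
  orthogonal {i} {k} i≢k = trans (CCᵀ≡ i k) (scalarId-offDiagonal _ i≢k)
  4∣n : 4 ℕ.∣ suc N
  4∣n = asymmetric⇒4∣n orthogonal {i} {j} Cij≢Cji
  d-from-c₀ : ∀ {M} → c zero ≡ fromℤ M → d ≡ M / 1
  d-from-c₀ {M} c₀≡M = trans (sym (c₀≡d zero refl)) (trans c₀≡M (sym (/1≡fromℤ M)))
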